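{- For all integers $p,q\geq 2$, $f(p+q)\leq 2+\max\{f(p),f(q)\}$.
   Context: A form $\sum_{i=1}^{m}a_iX_i^2$ with integer coefficients is called universal over $M_n(\mathbb{Z})$ if for every $A\in M_n(\mathbb{Z})$ there exist $X_1,\dots,X_m\in M_n(\mathbb{Z})$ with $A=\sum_{i=1}^{m}a_iX_i^2$. For an integer $n\geq 2$, $f(n)$ denotes the smallest positive integer $m$ such that for every choice of pairwise coprime integers $a_1,\dots,a_m$, the form $\sum_{i=1}^{m}a_iX_i^2$ is universal over $M_n(\mathbb{Z})$. -}

module Defs where

open import Data.Nat using (ℕ; zero; suc; _≤_)
open import Data.Fin using (Fin; zero; suc)
open import Data.Integer using (ℤ; 0ℤ; _+_; _*_)
open import Data.Integer.Coprimality using (Coprime)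
open import Data.Product using (Σ; _×_)
open import Relation.Binary.PropositionalEquality using (_≡_; _≢_)

sumFin : (n : ℕ) → (Fin n → ℤ) → ℤ
sumFin zero    f = 0ℤ
sumFin (suc n) f = f zero + sumFin n (λ i → f (suc i))

Mat : ℕ → Set
Mat n = Fin n → Fin n → ℤ

_⊕_ : {n : ℕ} → Mat n → Mat n → Mat n
(A ⊕ B) i j = A i j + B i j

_⊗_ : {n : ℕ} → Mat n → Mat n → Mat n
_⊗_ {n} A B i j = sumFin n (λ k → A i k * B k j)

_·_ : {n : ℕ} → ℤ → Mat n → Mat n
(c · A) i j = c * A i j

zeroMat : (n : ℕ) → Mat n
zeroMat n i j = 0ℤ

formValue : (n m : ℕ) → (Fin m → ℤ) → (Fin m → Mat n) → Mat n
formValue n zero    a X = zeroMat n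
formValue n (suc m) a X =
  (a zero · (X zero ⊗ X zero)) ⊕ formValue n m (λ i → a (suc i)) (λ i → X (suc i))

Universal : (n m : ℕ) → (Fin m → ℤ) → Set
Universal n m a = (A : Mat n) →
  Σ (Fin m → Mat n) (λ X → (i j : Fin n) → formValue n m a X i j ≡ A i j)

PairwiseCoprime : (m : ℕ) → (Fin m → ℤ) → Set
PairwiseCoprime m a = (i j : Fin m) → i ≢ j → Coprime (a i) (a j)

AllUniversal : (n m : ℕ) → Set
AllUniversal n m = (a : Fin m → ℤ) → PairwiseCoprime m a → Universal n m a

-- "f n ≡ m": m is the smallest positive integer with AllUniversal n m.
IsF : (n m : ℕ) → Set
IsF n m = (1 ≤ m) × AllUniversal n m × ((k : ℕ) → 1 ≤ k → AllUniversal n k → m ≤ k)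

-- Write A ∈ M_{p+q}(ℤ) in block form [[A₁₁, A₁₂], [A₂₁, A₂₂]] and let the
-- coefficients a₀, a₁, …, a_{m+1} be pairwise coprime, with s·a₀ + t·a₁ = 1
-- (Bézout).  For the "pivot" matrices
--     X₀ = [[I, s·A₁₂], [s·A₂₁, 0]]   and   X₁ = [[0, t·A₁₂], [t·A₂₁, I]]
-- the off-diagonal blocks of a₀X₀² + a₁X₁² are (s·a₀ + t·a₁)·A₁₂ = A₁₂ and
-- likewise A₂₁, so the residual A − a₀X₀² − a₁X₁² is block diagonal.  When the
-- tail form Σ_{i≥2} aᵢXᵢ² is universal over M_p(ℤ) and over M_q(ℤ), block
-- diagonal Xᵢ represent that residual, so the whole form represents A.
-- Universality of all coprime forms persists when variables are added (set
-- them to zero), so m = max (f p) (f q) serves for p and q, hence 2 + m for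
-- p + q, and minimality of f(p + q) gives the bound.
module Submission where

open import Defs

module MatrixForms where
  open import Data.Nat as ℕ using (ℕ; zero; suc; _≤_; _≤′_; ≤′-reflexive; ≤′-step)
  open import Data.Nat.Properties using (≤⇒≤′)
  import Data.Nat.Coprimality as ℕC
  open import Data.Nat.GCD using (module Bézout)
  open import Data.Fin using (Fin; zero; suc; _↑ˡ_; _↑ʳ_; splitAt; join)
  open import Data.Fin.Properties using (splitAt-↑ˡ; splitAt-↑ʳ; splitAt-join; join-splitAt; suc-injective)
  open import Data.Integer using (ℤ; 0ℤ; 1ℤ; +_; -[1+_]; -_; _+_; _*_; _-_; ∣_∣)
  import Data.Integer.Properties as ℤP
  open import Data.Integer.Coprimality using (Coprime)
  open import Data.Integer.Tactic.RingSolver using (solve-∀)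
  open import Data.Product using (Σ; ∃₂; _×_; _,_; proj₁; proj₂)
  open import Data.Sum using (_⊎_; inj₁; inj₂)
  open import Relation.Binary.PropositionalEquality
  open ≡-Reasoning

  bézout-from-ℕ : ∀ l m k n → 1 ℕ.+ k ℕ.* n ≡ l ℕ.* m → + l * + m + - + k * + n ≡ 1ℤ
  bézout-from-ℕ l m k n eq = begin
    + l * + m + - + k * + n        ≡⟨ negate-product (+ l * + m) (+ k) (+ n) ⟩
    + l * + m - + k * + n          ≡⟨ cong₂ _-_ (ℤP.pos-* l m) (ℤP.pos-* k n) ⟨
    + (l ℕ.* m) - + (k ℕ.* n)      ≡⟨ cong (λ r → + r - + (k ℕ.* n)) eq ⟨
    + (1 ℕ.+ k ℕ.* n) - + (k ℕ.* n) ≡⟨ cong (_- + (k ℕ.* n)) (ℤP.pos-+ 1 (k ℕ.* n)) ⟩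
    (1ℤ + + (k ℕ.* n)) - + (k ℕ.* n) ≡⟨ cancel (+ (k ℕ.* n)) ⟩
    1ℤ                             ∎
    where
    negate-product : ∀ u v w → u + - v * w ≡ u - v * w
    negate-product = solve-∀
    cancel : ∀ u → (1ℤ + u) - u ≡ 1ℤ
    cancel = solve-∀

  -- Bézout for coprime naturals with integer coefficients; the library
  -- gives one of two sign patterns over ℕ.
  bézout-ℕ : ∀ {m n} → ℕC.Coprime m n → ∃₂ λ x y → x * + m + y * + n ≡ 1ℤ
  bézout-ℕ {m} {n} c with ℕC.coprime-Bézout c
  ... | Bézout.+- x y eq = + x , - + y , bézout-from-ℕ x m y n eq
  ... | Bézout.-+ x y eq = - + x , + y ,
          trans (ℤP.+-comm (- + x * + m) (+ y * + n)) (bézout-from-ℕ y n x m eq)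

  signUnit : ℤ → ℤ
  signUnit (+ _)     = 1ℤ
  signUnit -[1+ _ ] = - 1ℤ

  abs-signUnit : ∀ a → + ∣ a ∣ ≡ signUnit a * a
  abs-signUnit (+ n)     = sym (ℤP.*-identityˡ (+ n))
  abs-signUnit -[1+ n ] = sym (ℤP.-1*i≡-i -[1+ n ])

  bézout : ∀ a b → Coprime a b → ∃₂ λ s t → s * a + t * b ≡ 1ℤ
  bézout a b c with bézout-ℕ c
  ... | x , y , eq = x * signUnit a , y * signUnit b , (begin
    x * signUnit a * a + y * signUnit b * b
      ≡⟨ cong₂ _+_ (ℤP.*-assoc x (signUnit a) a) (ℤP.*-assoc y (signUnit b) b) ⟩
    x * (signUnit a * a) + y * (signUnit b * b)
      ≡⟨ cong₂ (λ u v → x * u + y * v) (abs-signUnit a) (abs-signUnit b) ⟨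
    x * + ∣ a ∣ + y * + ∣ b ∣
      ≡⟨ eq ⟩
    1ℤ ∎)

  sumFin-cong : ∀ n {f g : Fin n → ℤ} → (∀ k → f k ≡ g k) → sumFin n f ≡ sumFin n g
  sumFin-cong zero    e = refl
  sumFin-cong (suc n) e = cong₂ _+_ (e zero) (sumFin-cong n (λ k → e (suc k)))

  sumFin-zero : ∀ n {f : Fin n → ℤ} → (∀ k → f k ≡ 0ℤ) → sumFin n f ≡ 0ℤ
  sumFin-zero zero    e = refl
  sumFin-zero (suc n) e = cong₂ _+_ (e zero) (sumFin-zero n (λ k → e (suc k)))

  sumFin-+ : ∀ p q (f : Fin (p ℕ.+ q) → ℤ) →
    sumFin (p ℕ.+ q) f ≡ sumFin p (λ k → f (k ↑ˡ q)) + sumFin q (λ k → f (p ↑ʳ k))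
  sumFin-+ zero    q f = sym (ℤP.+-identityˡ _)
  sumFin-+ (suc p) q f =
    trans (cong (λ r → f zero + r) (sumFin-+ p q (λ k → f (suc k))))
          (sym (ℤP.+-assoc (f zero) _ _))

  idMat : ∀ {n} → Mat n
  idMat zero    zero    = 1ℤ
  idMat zero    (suc _) = 0ℤ
  idMat (suc _) zero    = 0ℤ
  idMat (suc x) (suc y) = idMat x y

  idMat-sym : ∀ {n} (x y : Fin n) → idMat x y ≡ idMat y x
  idMat-sym zero    zero    = refl
  idMat-sym zero    (suc _) = refl
  idMat-sym (suc _) zero    = refl
  idMat-sym (suc x) (suc y) = idMat-sym x y

  idMat-sumˡ : ∀ n (x : Fin n) (g : Fin n → ℤ) → sumFin n (λ k → idMat x k * g k) ≡ g x
  idMat-sumˡ (suc n) zero g =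
    trans (cong₂ _+_ (ℤP.*-identityˡ (g zero)) (sumFin-zero n (λ k → ℤP.*-zeroˡ (g (suc k)))))
          (ℤP.+-identityʳ (g zero))
  idMat-sumˡ (suc n) (suc x) g =
    trans (cong₂ _+_ (ℤP.*-zeroˡ (g zero)) (idMat-sumˡ n x (λ k → g (suc k))))
          (ℤP.+-identityˡ _)

  idMat-sumʳ : ∀ n (y : Fin n) (g : Fin n → ℤ) → sumFin n (λ k → g k * idMat k y) ≡ g y
  idMat-sumʳ n y g =
    trans (sumFin-cong n (λ k → trans (ℤP.*-comm (g k) (idMat k y)) (cong (_* g k) (idMat-sym k y))))
          (idMat-sumˡ n y g)

  module Blocks (p q : ℕ) where

    Index : Set
    Index = Fin p ⊎ Fin q

    BlockMat : Set
    BlockMat = Index → Index → ℤ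

    toMat : BlockMat → Mat (p ℕ.+ q)
    toMat G i j = G (splitAt p i) (splitAt p j)

    toMat-join : ∀ G u v → toMat G (join p q u) (join p q v) ≡ G u v
    toMat-join G u v = cong₂ G (splitAt-join p q u) (splitAt-join p q v)

    ext-blocks : ∀ {M N : Mat (p ℕ.+ q)} →
      (∀ u v → M (join p q u) (join p q v) ≡ N (join p q u) (join p q v)) →
      ∀ i j → M i j ≡ N i j
    ext-blocks {M} {N} e i j =
      subst₂ (λ i′ j′ → M i′ j′ ≡ N i′ j′) (join-splitAt p q i) (join-splitAt p q j)
             (e (splitAt p i) (splitAt p j))

    _⊗ᴮ_ : BlockMat → BlockMat → BlockMat
    (G ⊗ᴮ H) u v = sumFin p (λ k → G u (inj₁ k) * H (inj₁ k) v)
                 + sumFin q (λ k → G u (inj₂ k) * H (inj₂ k) v)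

    toMat-⊗ : ∀ G H i j → (toMat G ⊗ toMat H) i j ≡ toMat (G ⊗ᴮ H) i j
    toMat-⊗ G H i j = trans (sumFin-+ p q _) (cong₂ _+_
      (sumFin-cong p (λ k → cong (λ w → G (splitAt p i) w * H w (splitAt p j)) (splitAt-↑ˡ p k q)))
      (sumFin-cong q (λ k → cong (λ w → G (splitAt p i) w * H w (splitAt p j)) (splitAt-↑ʳ p q k))))

    toMat-⊗-join : ∀ G H u v → (toMat G ⊗ toMat H) (join p q u) (join p q v) ≡ (G ⊗ᴮ H) u v
    toMat-⊗-join G H u v = trans (toMat-⊗ G H _ _) (toMat-join (G ⊗ᴮ H) u v)

    diag : Mat p → Mat q → BlockMat
    diag Y Z (inj₁ x) (inj₁ y) = Y x y
    diag Y Z (inj₁ x) (inj₂ y) = 0ℤ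
    diag Y Z (inj₂ x) (inj₁ y) = 0ℤ
    diag Y Z (inj₂ x) (inj₂ y) = Z x y

    diag-zero : ∀ u v → diag (zeroMat p) (zeroMat q) u v ≡ 0ℤ
    diag-zero (inj₁ x) (inj₁ y) = refl
    diag-zero (inj₁ x) (inj₂ y) = refl
    diag-zero (inj₂ x) (inj₁ y) = refl
    diag-zero (inj₂ x) (inj₂ y) = refl

    diag-square : ∀ Y Z u v → (diag Y Z ⊗ᴮ diag Y Z) u v ≡ diag (Y ⊗ Y) (Z ⊗ Z) u v
    diag-square Y Z (inj₁ x) (inj₁ y) =
      trans (cong (λ r → sumFin p (λ k → Y x k * Y k y) + r) (sumFin-zero q (λ k → refl)))
            (ℤP.+-identityʳ _)
    diag-square Y Z (inj₁ x) (inj₂ y) =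
      cong₂ _+_ (sumFin-zero p (λ k → ℤP.*-zeroʳ (Y x k))) (sumFin-zero q (λ k → ℤP.*-zeroˡ (Z k y)))
    diag-square Y Z (inj₂ x) (inj₁ y) =
      cong₂ _+_ (sumFin-zero p (λ k → ℤP.*-zeroˡ (Y k y))) (sumFin-zero q (λ k → ℤP.*-zeroʳ (Z x k)))
    diag-square Y Z (inj₂ x) (inj₂ y) =
      trans (cong (_+ sumFin q (λ k → Z x k * Z k y)) (sumFin-zero p (λ k → refl)))
            (ℤP.+-identityˡ _)

    diag-linear : ∀ c Y Z Y′ Z′ u v →
      c * diag Y Z u v + diag Y′ Z′ u v ≡ diag ((c · Y) ⊕ Y′) ((c · Z) ⊕ Z′) u v
    diag-linear c Y Z Y′ Z′ (inj₁ x) (inj₁ y) = refl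
    diag-linear c Y Z Y′ Z′ (inj₁ x) (inj₂ y) = trans (ℤP.+-identityʳ _) (ℤP.*-zeroʳ c)
    diag-linear c Y Z Y′ Z′ (inj₂ x) (inj₁ y) = trans (ℤP.+-identityʳ _) (ℤP.*-zeroʳ c)
    diag-linear c Y Z Y′ Z′ (inj₂ x) (inj₂ y) = refl

    formValue-diag : ∀ m a (Y : Fin m → Mat p) (Z : Fin m → Mat q) i j →
      formValue (p ℕ.+ q) m a (λ k → toMat (diag (Y k) (Z k))) i j
        ≡ toMat (diag (formValue p m a Y) (formValue q m a Z)) i j
    formValue-diag zero    a Y Z i j = sym (diag-zero (splitAt p i) (splitAt p j))
    formValue-diag (suc m) a Y Z i j = begin
      a zero * (toMat D₀ ⊗ toMat D₀) i j + formValue (p ℕ.+ q) m a′ (λ k → toMat (diag (Y′ k) (Z′ k))) i j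
        ≡⟨ cong₂ (λ s r → a zero * s + r)
                 (trans (toMat-⊗ D₀ D₀ i j) (diag-square (Y zero) (Z zero) u v))
                 (formValue-diag m a′ Y′ Z′ i j) ⟩
      a zero * diag (Y zero ⊗ Y zero) (Z zero ⊗ Z zero) u v + diag (formValue p m a′ Y′) (formValue q m a′ Z′) u v
        ≡⟨ diag-linear (a zero) _ _ _ _ u v ⟩
      toMat (diag (formValue p (suc m) a Y) (formValue q (suc m) a Z)) i j ∎
      where
      D₀ = diag (Y zero) (Z zero)
      a′ = λ k → a (suc k)
      Y′ = λ k → Y (suc k)
      Z′ = λ k → Z (suc k)
      u = splitAt p i
      v = splitAt p j

    BlockDiagonal : Mat (p ℕ.+ q) → Set
    BlockDiagonal M = ∀ x y → M (x ↑ˡ q) (p ↑ʳ y) ≡ 0ℤ × M (p ↑ʳ y) (x ↑ˡ q) ≡ 0ℤ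

    blockDiagonal-represented : ∀ {m a} → Universal p m a → Universal q m a →
      ∀ M → BlockDiagonal M → Σ (Fin m → Mat (p ℕ.+ q)) λ X → ∀ i j → formValue (p ℕ.+ q) m a X i j ≡ M i j
    blockDiagonal-represented {m} {a} Up Uq M M-diag =
      (λ k → toMat (diag (Y k) (Z k))) ,
      λ i j → trans (formValue-diag m a Y Z i j) (ext-blocks blocks i j)
      where
      upperLeft  = Up (λ x y → M (x ↑ˡ q) (y ↑ˡ q))
      lowerRight = Uq (λ x y → M (p ↑ʳ x) (p ↑ʳ y))
      Y = proj₁ upperLeft
      Z = proj₁ lowerRight
      block : ∀ u v → diag (formValue p m a Y) (formValue q m a Z) u v ≡ M (join p q u) (join p q v)
      block (inj₁ x) (inj₁ y) = proj₂ upperLeft x y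
      block (inj₁ x) (inj₂ y) = sym (proj₁ (M-diag x y))
      block (inj₂ y) (inj₁ x) = sym (proj₂ (M-diag x y))
      block (inj₂ x) (inj₂ y) = proj₂ lowerRight x y
      blocks : ∀ u v → toMat (diag (formValue p m a Y) (formValue q m a Z)) (join p q u) (join p q v)
                       ≡ M (join p q u) (join p q v)
      blocks u v = trans (toMat-join (diag (formValue p m a Y) (formValue q m a Z)) u v) (block u v)

    pivotUpper pivotLower : ℤ → Mat (p ℕ.+ q) → BlockMat
    pivotUpper c A (inj₁ x) (inj₁ y) = idMat x y
    pivotUpper c A (inj₁ x) (inj₂ y) = c * A (x ↑ˡ q) (p ↑ʳ y)
    pivotUpper c A (inj₂ x) (inj₁ y) = c * A (p ↑ʳ x) (y ↑ˡ q)
    pivotUpper c A (inj₂ x) (inj₂ y) = 0ℤ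
    pivotLower c A (inj₁ x) (inj₁ y) = 0ℤ
    pivotLower c A (inj₁ x) (inj₂ y) = c * A (x ↑ˡ q) (p ↑ʳ y)
    pivotLower c A (inj₂ x) (inj₁ y) = c * A (p ↑ʳ x) (y ↑ˡ q)
    pivotLower c A (inj₂ x) (inj₂ y) = idMat x y

    OffDiagonal : BlockMat → ℤ → Mat (p ℕ.+ q) → Set
    OffDiagonal G c A = ∀ x y → G (inj₁ x) (inj₂ y) ≡ c * A (x ↑ˡ q) (p ↑ʳ y)
                              × G (inj₂ y) (inj₁ x) ≡ c * A (p ↑ʳ y) (x ↑ˡ q)

    pivotUpper-square : ∀ c A → OffDiagonal (pivotUpper c A ⊗ᴮ pivotUpper c A) c A
    pivotUpper-square c A x y =
      trans (cong₂ _+_ (idMat-sumˡ p x (λ k → c * A (k ↑ˡ q) (p ↑ʳ y)))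
                       (sumFin-zero q (λ k → ℤP.*-zeroʳ (c * A (x ↑ˡ q) (p ↑ʳ k)))))
            (ℤP.+-identityʳ _) ,
      trans (cong₂ _+_ (idMat-sumʳ p x (λ k → c * A (p ↑ʳ y) (k ↑ˡ q)))
                       (sumFin-zero q (λ k → ℤP.*-zeroˡ (c * A (p ↑ʳ k) (x ↑ˡ q)))))
            (ℤP.+-identityʳ _)

    pivotLower-square : ∀ c A → OffDiagonal (pivotLower c A ⊗ᴮ pivotLower c A) c A
    pivotLower-square c A x y =
      trans (cong₂ _+_ (sumFin-zero p (λ k → ℤP.*-zeroˡ (c * A (k ↑ˡ q) (p ↑ʳ y))))
                       (idMat-sumʳ q y (λ k → c * A (x ↑ˡ q) (p ↑ʳ k))))
            (ℤP.+-identityˡ _) ,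
      trans (cong₂ _+_ (sumFin-zero p (λ k → ℤP.*-zeroʳ (c * A (p ↑ʳ y) (k ↑ˡ q))))
                       (idMat-sumˡ q y (λ k → c * A (p ↑ʳ k) (x ↑ˡ q))))
            (ℤP.+-identityˡ _)

    pivotSum : ℤ → ℤ → ℤ → ℤ → Mat (p ℕ.+ q) → Mat (p ℕ.+ q)
    pivotSum α β s t A = (α · (X₀ ⊗ X₀)) ⊕ (β · (X₁ ⊗ X₁))
      where
      X₀ = toMat (pivotUpper s A)
      X₁ = toMat (pivotLower t A)

    -- If s·α + t·β = 1 then A − pivotSum is block diagonal, since off the
    -- diagonal blocks pivotSum has entries α·(s·a) + β·(t·a) = a.
    pivotSum-residual : ∀ α β s t → s * α + t * β ≡ 1ℤ →
      ∀ A → BlockDiagonal (λ i j → A i j - pivotSum α β s t A i j)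
    pivotSum-residual α β s t bez A x y =
      residual-zero (inj₁ x) (inj₂ y) (proj₁ (pivotUpper-square s A x y)) (proj₁ (pivotLower-square t A x y)) ,
      residual-zero (inj₂ y) (inj₁ x) (proj₂ (pivotUpper-square s A x y)) (proj₂ (pivotLower-square t A x y))
      where
      G₀ = pivotUpper s A
      G₁ = pivotLower t A
      combination : ∀ α β s t a → α * (s * a) + β * (t * a) ≡ (s * α + t * β) * a
      combination = solve-∀
      residual-zero : ∀ u v → (G₀ ⊗ᴮ G₀) u v ≡ s * A (join p q u) (join p q v) →
                              (G₁ ⊗ᴮ G₁) u v ≡ t * A (join p q u) (join p q v) →
                              A (join p q u) (join p q v) - pivotSum α β s t A (join p q u) (join p q v) ≡ 0ℤ
      residual-zero u v sq₀ sq₁ = begin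
        a - (α * (toMat G₀ ⊗ toMat G₀) i j + β * (toMat G₁ ⊗ toMat G₁) i j)
          ≡⟨ cong (λ r → a - r) (cong₂ (λ P Q → α * P + β * Q)
                 (trans (toMat-⊗-join G₀ G₀ u v) sq₀) (trans (toMat-⊗-join G₁ G₁ u v) sq₁)) ⟩
        a - (α * (s * a) + β * (t * a))
          ≡⟨ cong (λ r → a - r) (trans (combination α β s t a) (trans (cong (_* a) bez) (ℤP.*-identityˡ a))) ⟩
        a - a
          ≡⟨ ℤP.+-inverseʳ a ⟩
        0ℤ ∎
        where
        i = join p q u
        j = join p q v
        a = A i j

  pairwiseCoprime-tail : ∀ {m} {a : Fin (suc m) → ℤ} →
    PairwiseCoprime (suc m) a → PairwiseCoprime m (λ i → a (suc i))
  pairwiseCoprime-tail coprime i j i≢j = coprime (suc i) (suc j) (λ e → i≢j (suc-injective e))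

  -- One more variable keeps all coprime forms universal: set it to zero.
  allUniversal-suc : ∀ n k → AllUniversal n k → AllUniversal n (suc k)
  allUniversal-suc n k U a coprime A = X , represents
    where
    tail = U (λ i → a (suc i)) (pairwiseCoprime-tail {a = a} coprime) A
    X : Fin (suc k) → Mat n
    X zero    = zeroMat n
    X (suc i) = proj₁ tail i
    represents : ∀ i j → formValue n (suc k) a X i j ≡ A i j
    represents i j = begin
      a zero * sumFin n (λ _ → 0ℤ) + rest ≡⟨ cong (λ s → a zero * s + rest) (sumFin-zero n (λ _ → refl)) ⟩
      a zero * 0ℤ + rest                  ≡⟨ cong (_+ rest) (ℤP.*-zeroʳ (a zero)) ⟩
      0ℤ + rest                           ≡⟨ ℤP.+-identityˡ rest ⟩
      rest                                ≡⟨ proj₂ tail i j ⟩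
      A i j                               ∎
      where
      rest = formValue n k (λ i → a (suc i)) (proj₁ tail) i j

  allUniversal-mono : ∀ n {k m} → k ≤ m → AllUniversal n k → AllUniversal n m
  allUniversal-mono n k≤m = go (≤⇒≤′ k≤m)
    where
    go : ∀ {k m} → k ≤′ m → AllUniversal n k → AllUniversal n m
    go (≤′-reflexive refl) U = U
    go (≤′-step k≤′m)      U = allUniversal-suc n _ (go k≤′m U)

  twoStep-universal : ∀ p q m (a : Fin (2 ℕ.+ m) → ℤ) → Coprime (a zero) (a (suc zero)) →
    Universal p m (λ i → a (suc (suc i))) → Universal q m (λ i → a (suc (suc i))) →
    Universal (p ℕ.+ q) (2 ℕ.+ m) a
  twoStep-universal p q m a coprime Up Uq A = X , represents
    where
    open Blocks p q
    α = a zero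
    β = a (suc zero)
    coefficients = bézout α β coprime
    s = proj₁ coefficients
    t = proj₁ (proj₂ coefficients)
    S = pivotSum α β s t A
    rest = blockDiagonal-represented Up Uq (λ i j → A i j - S i j)
             (pivotSum-residual α β s t (proj₂ (proj₂ coefficients)) A)
    X : Fin (2 ℕ.+ m) → Mat (p ℕ.+ q)
    X zero          = toMat (pivotUpper s A)
    X (suc zero)    = toMat (pivotLower t A)
    X (suc (suc k)) = proj₁ rest k
    add-residual : ∀ P Q a → P + (Q + (a - (P + Q))) ≡ a
    add-residual = solve-∀
    represents : ∀ i j → formValue (p ℕ.+ q) (2 ℕ.+ m) a X i j ≡ A i j
    represents i j = begin
      α * (X zero ⊗ X zero) i j + (β * (X (suc zero) ⊗ X (suc zero)) i j
        + formValue (p ℕ.+ q) m (λ k → a (suc (suc k))) (proj₁ rest) i j)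
        ≡⟨ cong (λ r → P + (Q + r)) (proj₂ rest i j) ⟩
      α * (X zero ⊗ X zero) i j + (β * (X (suc zero) ⊗ X (suc zero)) i j + (A i j - S i j))
        ≡⟨ add-residual P Q (A i j) ⟩
      A i j ∎
      where
      P = α * (X zero ⊗ X zero) i j
      Q = β * (X (suc zero) ⊗ X (suc zero)) i j

  allUniversal-+ : ∀ p q m → AllUniversal p m → AllUniversal q m → AllUniversal (p ℕ.+ q) (2 ℕ.+ m)
  allUniversal-+ p q m Up Uq a coprime =
    twoStep-universal p q m a (coprime zero (suc zero) (λ ()))
      (Up tail tail-coprime) (Uq tail tail-coprime)
    where
    tail = λ i → a (suc (suc i))
    tail-coprime = pairwiseCoprime-tail {a = λ i → a (suc i)} (pairwiseCoprime-tail {a = a} coprime)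

open MatrixForms using (allUniversal-mono; allUniversal-+)

open import Data.Nat using (ℕ; _≤_; _+_; _⊔_; s≤s; z≤n)
open import Data.Nat.Properties using (m≤m⊔n; m≤n⊔m)
open import Data.Product using (_×_; _,_)

lemma3p1 : (p q : ℕ) → 2 ≤ p → 2 ≤ q → (fp fq : ℕ) → IsF p fp → IsF q fq →
    AllUniversal (p + q) (2 + (fp ⊔ fq))
      × ((fpq : ℕ) → IsF (p + q) fpq → fpq ≤ 2 + (fp ⊔ fq))
lemma3p1 p q _ _ fp fq (_ , Up , _) (_ , Uq , _) =
  universal , λ fpq (_ , _ , minimal) → minimal (2 + (fp ⊔ fq)) (s≤s z≤n) universal
  where
  universal : AllUniversal (p + q) (2 + (fp ⊔ fq))
  universal = allUniversal-+ p q (fp ⊔ fq)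
    (allUniversal-mono p (m≤m⊔n fp fq) Up)
    (allUniversal-mono q (m≤n⊔m fp fq) Uq)
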